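{- Let $m$ be a positive integer and $g$ a divisor of $m$ with $s_g(m)\ge g$ (so $m\in\mathcal{S}'_{\mathcal L}$). Then: (i) $m$ has at least two distinct prime divisors; (ii) if $m$ is a Carmichael number with exactly three prime factors, then $g$ is an odd prime; (iii) $1<g<m^{1/(\operatorname{ord}_g(m)+1)}\le\sqrt m$.
   Context: For an integer base $g\ge 2$ and integer $m\ge 0$, $s_g(m)$ denotes the sum of the base-$g$ digits of $m$; by convention $s_1(m):=0$. For integers $g\ge 2$, $m\ge1$, $\operatorname{ord}_g(m):=\max\{n\ge0:g^n\mid m\}$. $\mathcal{S}'_{\mathcal L}$ denotes the set of positive integers $m$ having a divisor $g$ with $s_g(m)\ge g$. A Carmichael number is a composite positive integer $m$ with $a^{m-1}\equiv1\pmod m$ for all integers $a$ coprime to $m$. -}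

module Defs where

open import Data.Nat using (ℕ; zero; suc; _+_; _*_; _∸_; _^_; _≤_; _<_; NonZero)
open import Data.Nat.DivMod using (_/_; _%_)
open import Data.Nat.Divisibility using (_∣_)
open import Data.Nat.Coprimality using (Coprime)
open import Data.Nat.Primality using (Composite)
open import Data.Product using (_×_)
open import Relation.Binary.PropositionalEquality using (_≡_)

-- Base-b digit sum with a fuel argument (fuel ≥ m suffices, since m / b < m
-- for m ≥ 1 and b ≥ 2; once m reaches 0 all further digits are 0).
-- Bases 0 and 1 give 0 (s_1 := 0 by convention; base 0 is never used).
digitSumFuel : ℕ → ℕ → ℕ → ℕ
digitSumFuel zero    b             m = 0
digitSumFuel (suc f) zero          m = 0
digitSumFuel (suc f) (suc zero)    m = 0
digitSumFuel (suc f) (suc (suc h)) m =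
  m % suc (suc h) + digitSumFuel f (suc (suc h)) (m / suc (suc h))

s : ℕ → ℕ → ℕ
s g m = digitSumFuel m g m

IsOrd : ℕ → ℕ → ℕ → Set
IsOrd g m n = (g ^ n ∣ m) × (∀ k → g ^ k ∣ m → k ≤ n)

Carmichael : (m : ℕ) → .{{NonZero m}} → Set
Carmichael m = Composite m × (∀ a → Coprime a m → (a ^ (m ∸ 1)) % m ≡ 1 % m)

{-# OPTIONS --safe #-}
-- Write m = g ^ n * k with g ∤ k. Appending zero digits does not change a base-g digit sum, so
-- s_g(m) = s_g(k), which is k itself when k < g; hence s_g(m) ≥ g forces k > g, and then
-- g ^ (n + 1) < m with n ≥ 1. If m were a prime power, g and k would be powers of one prime with
-- g < k, so g ∣ k. If m = pqr is a Carmichael number, a divisor g with g² < m is either prime or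
-- the product c of two of p, q, r with the third prime w exceeding it. The latter is impossible:
-- every unit j modulo w lifts to a unit modulo m, so j ^ (m - 1) ≡ 1 (mod w), and m - 1 ≡ c - 1
-- (mod w - 1); thus all units are roots of x ^ (c - 1) - 1, contradicting Lagrange's theorem as
-- 0 < c - 1 < w - 1. Finally g ≠ 2 because Carmichael numbers are odd.
module Submission where

open import Data.Nat.Base as ℕ using (ℕ; zero; suc; z≤n; s≤s; z<s; s<s; NonZero)
import Data.Nat.Properties as ℕ
import Data.Nat.Divisibility as ℕ
open import Data.Nat.Primality using (Prime; euclidsLemma; prime⇒nonZero; prime⇒nonTrivial)
open import Data.Product using (∃; ∃₂; _×_; _,_; proj₁)
open import Data.Sum using (_⊎_; inj₁; inj₂; [_,_]′)
open import Relation.Nullary using (¬_; contradiction)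
open import Relation.Binary.PropositionalEquality

prime>1 : ∀ {p} → Prime p → 1 ℕ.< p
prime>1 {p} pp = ℕ.nonTrivial⇒n>1 p {{prime⇒nonTrivial pp}}

module Congruence where

  open import Data.Integer.Base using (ℤ; +_; _+_; _-_; -_; _*_; _^_; 0ℤ; 1ℤ; ∣_∣)
  open import Data.Integer.Properties
    using (+-inverseʳ; *-zeroˡ; pos-*; abs-*; m-n≡m⊖n; ∣⊖∣-<)
  open import Data.Integer.Divisibility.Signed
    using (_∣_; divides; ∣ᵤ⇒∣; ∣⇒∣ᵤ; ∣m∣n⇒∣m+n; ∣m∣n⇒∣m-n; ∣m⇒∣m*n; ∣n⇒∣m*n; ∣m⇒∣-m; ∣-trans)
  open import Data.Integer.Tactic.RingSolver using (solve-∀)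

  -- A record rather than a synonym for n ∣ x - y, so that x, y and n can be inferred.
  infix 4 _≈_mod_
  record _≈_mod_ (x y n : ℤ) : Set where
    constructor ≈mod
    field ∣diff : n ∣ x - y
  open _≈_mod_ public

  ≡⇒≈mod : ∀ {n x y} → x ≡ y → x ≈ y mod n
  ≡⇒≈mod {n} {x} refl = ≈mod (divides 0ℤ (trans (+-inverseʳ x) (sym (*-zeroˡ n))))

  ≈mod-sym : ∀ {n x y} → x ≈ y mod n → y ≈ x mod n
  ≈mod-sym {n} {x} {y} (≈mod n∣x-y) = ≈mod (subst (n ∣_) (negate x y) (∣m⇒∣-m n∣x-y))
    where
    negate : ∀ x y → - (x - y) ≡ y - x
    negate = solve-∀

  ≈mod-trans : ∀ {n x y z} → x ≈ y mod n → y ≈ z mod n → x ≈ z mod n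
  ≈mod-trans {n} {x} {y} {z} (≈mod n∣x-y) (≈mod n∣y-z) =
    ≈mod (subst (n ∣_) (telescope x y z) (∣m∣n⇒∣m+n n∣x-y n∣y-z))
    where
    telescope : ∀ x y z → (x - y) + (y - z) ≡ x - z
    telescope = solve-∀

  ≈mod-+ : ∀ {n x y u v} → x ≈ y mod n → u ≈ v mod n → x + u ≈ y + v mod n
  ≈mod-+ {n} {x} {y} {u} {v} (≈mod n∣x-y) (≈mod n∣u-v) =
    ≈mod (subst (n ∣_) (regroup x y u v) (∣m∣n⇒∣m+n n∣x-y n∣u-v))
    where
    regroup : ∀ x y u v → (x - y) + (u - v) ≡ (x + u) - (y + v)
    regroup = solve-∀

  ≈mod-* : ∀ {n x y u v} → x ≈ y mod n → u ≈ v mod n → x * u ≈ y * v mod n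
  ≈mod-* {n} {x} {y} {u} {v} (≈mod n∣x-y) (≈mod n∣u-v) =
    ≈mod (subst (n ∣_) (regroup x y u v) (∣m∣n⇒∣m+n (∣m⇒∣m*n u n∣x-y) (∣n⇒∣m*n y n∣u-v)))
    where
    regroup : ∀ x y u v → (x - y) * u + y * (u - v) ≡ x * u - y * v
    regroup = solve-∀

  ≈mod-^ : ∀ {n x y} k → x ≈ y mod n → x ^ k ≈ y ^ k mod n
  ≈mod-^ zero    x≈y = ≡⇒≈mod refl
  ≈mod-^ (suc k) x≈y = ≈mod-* x≈y (≈mod-^ k x≈y)

  ≈mod-∣ : ∀ {d n x y} → d ∣ n → x ≈ y mod n → x ≈ y mod d
  ≈mod-∣ d∣n (≈mod n∣x-y) = ≈mod (∣-trans d∣n n∣x-y)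

  ≈mod-resp-∣ : ∀ {n x y} → x ≈ y mod n → n ∣ x → n ∣ y
  ≈mod-resp-∣ {n} {x} {y} (≈mod n∣x-y) n∣x = subst (n ∣_) (cancel x y) (∣m∣n⇒∣m-n n∣x n∣x-y)
    where
    cancel : ∀ x y → x - (x - y) ≡ y
    cancel = solve-∀

  pos-^ : ∀ a k → + (a ℕ.^ k) ≡ (+ a) ^ k
  pos-^ a zero    = refl
  pos-^ a (suc k) = trans (pos-* a (a ℕ.^ k)) (cong (+ a *_) (pos-^ a k))

  euclidsLemmaℤ : ∀ {p} x y → Prime p → + p ∣ x * y → (+ p ∣ x) ⊎ (+ p ∣ y)
  euclidsLemmaℤ {p} x y pp p∣xy
    with euclidsLemma ∣ x ∣ ∣ y ∣ pp (subst (p ℕ.∣_) (abs-* x y) (∣⇒∣ᵤ p∣xy))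
  ... | inj₁ p∣x = inj₁ (∣ᵤ⇒∣ p∣x)
  ... | inj₂ p∣y = inj₂ (∣ᵤ⇒∣ p∣y)

  ¬≈mod-of-< : ∀ {p x y} → x ℕ.< y → y ℕ.< p → ¬ (+ x ≈ + y mod + p)
  ¬≈mod-of-< {p} {x} {y} x<y y<p x≈y =
    ℕ.<⇒≱ (ℕ.≤-<-trans (ℕ.m∸n≤m y x) y<p) (ℕ.∣⇒≤ {{ℕ.>-nonZero (ℕ.m<n⇒0<n∸m x<y)}} p∣y∸x)
    where
    p∣y∸x : p ℕ.∣ y ℕ.∸ x
    p∣y∸x = subst (p ℕ.∣_) (trans (cong ∣_∣ (m-n≡m⊖n x y)) (∣⊖∣-< x<y)) (∣⇒∣ᵤ (∣diff x≈y))

module Fermat where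

  open Congruence
  open import Data.Nat.Base using (_!)
  open import Data.Nat.Combinatorics using (_C_; nCn≡1; k![n∸k]!∣n!)
  open import Data.Nat.Combinatorics.Specification using (nCk≡n!/k![n-k]!)
  open import Data.Nat.DivMod using (m/n*n≡m)
  open import Data.Nat.Primality using (¬prime[0])
  open import Data.Integer.Base using (ℤ; +_; _+_; _-_; _*_; _^_; 0ℤ; 1ℤ; +-0-rawMonoid)
  import Data.Integer.Properties as ℤ
  open import Data.Integer.Divisibility.Signed
    using (_∣_; divides; ∣ᵤ⇒∣; ∣⇒∣ᵤ; ∣m∣n⇒∣m+n; ∣m⇒∣m*n)
  open import Data.Integer.Tactic.RingSolver using (solve-∀)
  open import Data.Fin.Base as Fin using (toℕ)
  import Data.Fin.Properties as Fin
  open import Data.Vec.Functional using (Vector; init; last; tail)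
  open import Algebra.Properties.CommutativeSemiring.Binomial ℤ.+-*-commutativeSemiring
    using () renaming (theorem to binomial-theorem)
  open import Algebra.Properties.Semiring.Exp ℤ.+-*-semiring using () renaming (_^_ to _^ₛ_)
  open import Algebra.Properties.Monoid.Sum ℤ.+-0-monoid using (sum; sum-init-last)
  open import Algebra.Definitions.RawMonoid +-0-rawMonoid using () renaming (_×_ to _·_)

  prime∤! : ∀ {p n} → Prime p → n ℕ.< p → ¬ p ℕ.∣ n !
  prime∤! {n = zero}  pp _   p∣1   = ℕ.<⇒≢ (prime>1 pp) (sym (ℕ.∣1⇒≡1 p∣1))
  prime∤! {n = suc n} pp n<p p∣n! with euclidsLemma (suc n) (n !) pp p∣n!
  ... | inj₁ p∣1+n = ℕ.<⇒≱ n<p (ℕ.∣⇒≤ p∣1+n)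
  ... | inj₂ p∣n!  = prime∤! pp (ℕ.<-trans (ℕ.n<1+n n) n<p) p∣n!

  C*k!*[n∸k]!≡n! : ∀ {n k} → k ℕ.≤ n → (n C k) ℕ.* (k ! ℕ.* (n ℕ.∸ k) !) ≡ n !
  C*k!*[n∸k]!≡n! {n} {k} k≤n =
    trans (cong (λ c → c ℕ.* (k ! ℕ.* (n ℕ.∸ k) !)) (nCk≡n!/k![n-k]! k≤n))
          (m/n*n≡m {{ℕ._!*_!≢0 k (n ℕ.∸ k)}} (k![n∸k]!∣n! k≤n))

  prime∣C : ∀ {p k} → Prime p → 0 ℕ.< k → k ℕ.< p → p ℕ.∣ p C k
  prime∣C {suc n} {k} pp 0<k k<p
    with euclidsLemma (suc n C k) (k ! ℕ.* (suc n ℕ.∸ k) !) pp p∣C*k!*[p∸k]!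
    where
    p∣C*k!*[p∸k]! : suc n ℕ.∣ (suc n C k) ℕ.* (k ! ℕ.* (suc n ℕ.∸ k) !)
    p∣C*k!*[p∸k]! = subst (suc n ℕ.∣_) (sym (C*k!*[n∸k]!≡n! (ℕ.<⇒≤ k<p))) (ℕ.m∣m*n (n !))
  ... | inj₁ p∣C = p∣C
  ... | inj₂ p∣k!*[p∸k]! with euclidsLemma (k !) ((suc n ℕ.∸ k) !) pp p∣k!*[p∸k]!
  ...   | inj₁ p∣k!     = contradiction p∣k! (prime∤! pp k<p)
  ...   | inj₂ p∣[p∸k]! = contradiction p∣[p∸k]! (prime∤! pp (ℕ.∸-monoʳ-< 0<k (ℕ.<⇒≤ k<p)))

  ^ₛ≡^ : ∀ x n → x ^ₛ n ≡ x ^ n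
  ^ₛ≡^ x zero    = refl
  ^ₛ≡^ x (suc n) = cong (x *_) (^ₛ≡^ x n)

  ·≡* : ∀ n x → n · x ≡ + n * x
  ·≡* zero    x = sym (ℤ.*-zeroˡ x)
  ·≡* (suc n) x = begin
    x + n · x        ≡⟨ cong (λ t → x + t) (·≡* n x) ⟩
    x + + n * x      ≡⟨ cong (_+ + n * x) (ℤ.*-identityˡ x) ⟨
    1ℤ * x + + n * x ≡⟨ ℤ.*-distribʳ-+ x 1ℤ (+ n) ⟨
    + suc n * x      ∎
    where open ≡-Reasoning

  ∣· : ∀ {d n} x → d ℕ.∣ n → + d ∣ n · x
  ∣· {n = n} x d∣n = subst (_ ∣_) (sym (·≡* n x)) (∣m⇒∣m*n {m = + n} x (∣ᵤ⇒∣ d∣n))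

  ∣sum : ∀ {d n} (t : Vector ℤ n) → (∀ i → d ∣ t i) → d ∣ sum t
  ∣sum {n = zero}  t d∣t = divides 0ℤ refl
  ∣sum {n = suc n} t d∣t = ∣m∣n⇒∣m+n (d∣t Fin.zero) (∣sum (tail t) (λ i → d∣t (Fin.suc i)))

  binomial-term : ∀ n → ℤ → ℤ → Vector ℤ (suc n)
  binomial-term n x y k = (n C toℕ k) · (x ^ₛ toℕ k * y ^ₛ (n ℕ.∸ toℕ k))

  freshman : ∀ {p} → Prime p → ∀ x y → (x + y) ^ p ≈ x ^ p + y ^ p mod + p
  freshman {zero}  pp = contradiction pp ¬prime[0]
  freshman {suc n} pp x y = ≈mod (subst (+ suc n ∣_) (sym difference≡middle) p∣middle)
    where
    open ≡-Reasoning
    t = binomial-term (suc n) x y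
    middle = sum (init (tail t))

    expansion : (x + y) ^ suc n ≡ t Fin.zero + (middle + last (tail t))
    expansion = begin
      (x + y) ^ suc n   ≡⟨ ^ₛ≡^ (x + y) (suc n) ⟨
      (x + y) ^ₛ suc n  ≡⟨ binomial-theorem (suc n) x y ⟩
      sum t             ≡⟨ cong (λ s → t Fin.zero + s) (sum-init-last (tail t)) ⟩
      t Fin.zero + (middle + last (tail t)) ∎

    first-term : t Fin.zero ≡ y ^ suc n
    first-term = begin
      1 · (1ℤ * y ^ₛ suc n)  ≡⟨ ·≡* 1 _ ⟩
      1ℤ * (1ℤ * y ^ₛ suc n) ≡⟨ ℤ.*-identityˡ _ ⟩
      1ℤ * y ^ₛ suc n        ≡⟨ ℤ.*-identityˡ _ ⟩
      y ^ₛ suc n             ≡⟨ ^ₛ≡^ y (suc n) ⟩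
      y ^ suc n              ∎

    last-term : last (tail t) ≡ x ^ suc n
    last-term = begin
      last (tail t)
        ≡⟨ cong (λ j → (suc n C suc j) · (x ^ₛ suc j * y ^ₛ (n ℕ.∸ j))) (Fin.toℕ-fromℕ n) ⟩
      (suc n C suc n) · (x ^ₛ suc n * y ^ₛ (n ℕ.∸ n))
        ≡⟨ cong₂ (λ c e → c · (x ^ₛ suc n * y ^ₛ e)) (nCn≡1 (suc n)) (ℕ.n∸n≡0 n) ⟩
      1 · (x ^ₛ suc n * 1ℤ) ≡⟨ ·≡* 1 _ ⟩
      1ℤ * (x ^ₛ suc n * 1ℤ) ≡⟨ ℤ.*-identityˡ _ ⟩
      x ^ₛ suc n * 1ℤ        ≡⟨ ℤ.*-identityʳ _ ⟩
      x ^ₛ suc n             ≡⟨ ^ₛ≡^ x (suc n) ⟩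
      x ^ suc n              ∎

    cancel : ∀ u v w → (u + (v + w)) - (w + u) ≡ v
    cancel = solve-∀

    difference≡middle : (x + y) ^ suc n - (x ^ suc n + y ^ suc n) ≡ middle
    difference≡middle = begin
      (x + y) ^ suc n - (x ^ suc n + y ^ suc n)
        ≡⟨ cong (_- (x ^ suc n + y ^ suc n)) expansion ⟩
      (t Fin.zero + (middle + last (tail t))) - (x ^ suc n + y ^ suc n)
        ≡⟨ cong₂ (λ u w → (u + (middle + w)) - (x ^ suc n + y ^ suc n)) first-term last-term ⟩
      (y ^ suc n + (middle + x ^ suc n)) - (x ^ suc n + y ^ suc n)
        ≡⟨ cancel (y ^ suc n) middle (x ^ suc n) ⟩
      middle ∎

    p∣middle : + suc n ∣ middle
    p∣middle = ∣sum _ λ i →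
      ∣· _ (prime∣C pp z<s (s<s (subst (ℕ._< n) (sym (Fin.toℕ-inject₁ i)) (Fin.toℕ<n i))))

  fermat : ∀ {p} → Prime p → ∀ a → (+ a) ^ p ≈ + a mod + p
  fermat {zero}  pp = contradiction pp ¬prime[0]
  fermat {suc n} pp zero    = ≡⇒≈mod refl
  fermat {suc n} pp (suc a) =
    ≈mod-trans (freshman pp 1ℤ (+ a)) (≈mod-+ (≡⇒≈mod (ℤ.^-zeroˡ (suc n))) (fermat pp a))

  fermat-little : ∀ {p a} → Prime p → ¬ p ℕ.∣ a → (+ a) ^ (p ℕ.∸ 1) ≈ 1ℤ mod + p
  fermat-little {zero} pp = contradiction pp ¬prime[0]
  fermat-little {suc n} {a} pp p∤a
    with euclidsLemmaℤ (+ a) ((+ a) ^ n - 1ℤ) pp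
           (subst (+ suc n ∣_) (factor (+ a) ((+ a) ^ n)) (∣diff (fermat pp a)))
    where
    factor : ∀ x y → x * y - x ≡ x * (y - 1ℤ)
    factor = solve-∀
  ... | inj₁ p∣a       = contradiction (∣⇒∣ᵤ p∣a) p∤a
  ... | inj₂ p∣aⁿ-1    = ≈mod p∣aⁿ-1

module Polynomial where

  open Congruence
  open import Data.Integer.Base using (ℤ; +_; _+_; _-_; -_; _*_; _^_; 0ℤ; 1ℤ; -1ℤ)
  import Data.Integer.Properties as ℤ
  open import Data.Integer.Divisibility.Signed
    using (_∣_; ∣⇒∣ᵤ; ∣n⇒∣m*n; ∣m+n∣n⇒∣m; ∣m∣n⇒∣m-n)
  open import Data.Integer.Tactic.RingSolver using (solve-∀)
  open import Data.List.Base using (List; []; _∷_; length; applyUpTo)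
  open import Data.List.Properties using (length-applyUpTo)
  open import Data.List.Relation.Unary.All as All using (All; []; _∷_)
  import Data.List.Relation.Unary.All.Properties as All
  open import Data.List.Relation.Unary.AllPairs using (AllPairs; []; _∷_)
  import Data.List.Relation.Unary.AllPairs.Properties as AllPairs

  eval : List ℤ → ℤ → ℤ
  eval []       x = 0ℤ
  eval (c ∷ cs) x = c + x * eval cs x

  -- The quotient of c + x * eval cs x by x - a; it does not depend on c.
  quotient : ℤ → List ℤ → List ℤ
  quotient a []       = []
  quotient a (d ∷ ds) = eval (d ∷ ds) a ∷ quotient a ds

  length-quotient : ∀ a cs → length (quotient a cs) ≡ length cs
  length-quotient a []       = refl
  length-quotient a (d ∷ ds) = cong suc (length-quotient a ds)

  eval-division : ∀ a c cs x →
                  eval (c ∷ cs) x ≡ (x - a) * eval (quotient a cs) x + eval (c ∷ cs) a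
  eval-division a c []       x = constant c x a
    where
    constant : ∀ c x a → c + x * 0ℤ ≡ (x - a) * 0ℤ + (c + a * 0ℤ)
    constant = solve-∀
  eval-division a c (d ∷ ds) x = begin
    c + x * eval (d ∷ ds) x
      ≡⟨ cong (λ g → c + x * g) (eval-division a d ds x) ⟩
    c + x * ((x - a) * eval (quotient a ds) x + eval (d ∷ ds) a)
      ≡⟨ step c x a (eval (quotient a ds) x) (eval (d ∷ ds) a) ⟩
    (x - a) * (eval (d ∷ ds) a + x * eval (quotient a ds) x) + (c + a * eval (d ∷ ds) a) ∎
    where
    open ≡-Reasoning
    step : ∀ c x a q g → c + x * ((x - a) * q + g) ≡ (x - a) * (g + x * q) + (c + a * g)
    step = solve-∀

  ∣quotient⇒∣coefficients : ∀ {n} a c cs → All (n ∣_) (quotient a cs) → n ∣ eval (c ∷ cs) a →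
                            All (n ∣_) (c ∷ cs)
  ∣quotient⇒∣coefficients {n} a c []       []                 n∣c+a*0 =
    subst (n ∣_) (trans (cong (_+_ c) (ℤ.*-zeroʳ a)) (ℤ.+-identityʳ c)) n∣c+a*0 ∷ []
  ∣quotient⇒∣coefficients     a c (d ∷ ds) (n∣q₀ ∷ n∣quotient) n∣c+a*q₀ =
    ∣m+n∣n⇒∣m n∣c+a*q₀ (∣n⇒∣m*n a n∣q₀) ∷ ∣quotient⇒∣coefficients a d ds n∣quotient n∣q₀

  quotient-root : ∀ {p a b c cs} → Prime p → + p ∣ eval (c ∷ cs) a → + p ∣ eval (c ∷ cs) b →
                  ¬ a ≈ b mod + p → + p ∣ eval (quotient a cs) b
  quotient-root {p} {a} {b} {c} {cs} pp p∣f[a] p∣f[b] a≉b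
    with euclidsLemmaℤ (b - a) (eval (quotient a cs) b) pp p∣[b-a]*q[b]
    where
    cancel : ∀ u v w → (u * v + w) - w ≡ u * v
    cancel = solve-∀
    p∣[b-a]*q[b] : + p ∣ (b - a) * eval (quotient a cs) b
    p∣[b-a]*q[b] = subst (+ p ∣_)
      (trans (cong (_- eval (c ∷ cs) a) (eval-division a c cs b))
             (cancel (b - a) (eval (quotient a cs) b) (eval (c ∷ cs) a)))
      (∣m∣n⇒∣m-n p∣f[b] p∣f[a])
  ... | inj₁ p∣b-a  = contradiction (≈mod-sym (≈mod p∣b-a)) a≉b
  ... | inj₂ p∣q[b] = p∣q[b]

  -- Lagrange's theorem; `length f ≡ length rs` says that f has degree below the number of roots.
  lagrange : ∀ {p} → Prime p → ∀ f rs → length f ≡ length rs →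
             AllPairs (λ a b → ¬ a ≈ b mod + p) rs → All (λ r → + p ∣ eval f r) rs →
             All (+ p ∣_) f
  lagrange     pp []       []       _   _                    _               = []
  lagrange {p} pp (c ∷ cs) (a ∷ rs) len (a≉rs ∷ rs-distinct) (p∣f[a] ∷ p∣f[rs]) =
    ∣quotient⇒∣coefficients a c cs
      (lagrange pp (quotient a cs) rs (trans (length-quotient a cs) (ℕ.suc-injective len))
        rs-distinct (All.zipWith quotient-roots (a≉rs , p∣f[rs])))
      p∣f[a]
    where
    quotient-roots : ∀ {r} → (¬ a ≈ r mod + p) × (+ p ∣ eval (c ∷ cs) r) →
                     + p ∣ eval (quotient a cs) r
    quotient-roots (a≉r , p∣f[r]) = quotient-root {c = c} {cs = cs} pp p∣f[a] p∣f[r] a≉r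

  monomial : ℕ → List ℤ
  monomial zero    = 1ℤ ∷ []
  monomial (suc k) = 0ℤ ∷ monomial k

  length-monomial : ∀ k → length (monomial k) ≡ suc k
  length-monomial zero    = refl
  length-monomial (suc k) = cong suc (length-monomial k)

  eval-monomial : ∀ k x → eval (monomial k) x ≡ x ^ k
  eval-monomial zero    x = trans (cong (_+_ 1ℤ) (ℤ.*-zeroʳ x)) (ℤ.+-identityʳ 1ℤ)
  eval-monomial (suc k) x = trans (ℤ.+-identityˡ _) (cong (x *_) (eval-monomial k x))

  ∣monomial⇒∣1 : ∀ {n} k → All (n ∣_) (monomial k) → n ∣ 1ℤ
  ∣monomial⇒∣1 zero    (n∣1 ∷ []) = n∣1
  ∣monomial⇒∣1 (suc k) (_ ∷ n∣xᵏ) = ∣monomial⇒∣1 k n∣xᵏ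

  -- Lagrange's theorem for x ^ e - 1 at the e + 1 roots 1, 2, …, e + 1.
  ∀pow≈1⇒p≤1+e : ∀ {p e} → Prime p → 0 ℕ.< e → (∀ j → ¬ p ℕ.∣ j → (+ j) ^ e ≈ 1ℤ mod + p) →
                 p ℕ.≤ suc e
  ∀pow≈1⇒p≤1+e {p} {suc d} pp _ units-are-roots = ℕ.≮⇒≥ λ 2+d<p →
    ℕ.<⇒≢ (prime>1 pp) (sym (ℕ.∣1⇒≡1 (∣⇒∣ᵤ (∣monomial⇒∣1 d (∣-tail
      (lagrange pp xᵉ-1 roots length-roots (distinct 2+d<p) (vanishes 2+d<p)))))))
    where
    xᵉ-1 = -1ℤ ∷ monomial d
    root : ℕ → ℤ
    root j = + suc j
    roots = applyUpTo root (suc (suc d))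

    length-roots : length xᵉ-1 ≡ length roots
    length-roots = trans (cong suc (length-monomial d)) (sym (length-applyUpTo root (suc (suc d))))

    distinct : suc (suc d) ℕ.< p → AllPairs (λ a b → ¬ a ≈ b mod + p) roots
    distinct 2+d<p = AllPairs.applyUpTo⁺₁ root (suc (suc d)) λ i<j j<2+d →
      ¬≈mod-of-< (s<s i<j) (ℕ.<-≤-trans (s<s j<2+d) 2+d<p)

    shape : ∀ x y → -1ℤ + x * y ≡ x * y - 1ℤ
    shape = solve-∀

    vanishes : suc (suc d) ℕ.< p → All (λ r → + p ∣ eval xᵉ-1 r) roots
    vanishes 2+d<p = All.applyUpTo⁺₁ root (suc (suc d)) λ {j} j<2+d → subst (+ p ∣_)
      (sym (trans (cong (λ y → -1ℤ + + suc j * y) (eval-monomial d (+ suc j)))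
                  (shape (+ suc j) ((+ suc j) ^ d))))
      (∣diff (units-are-roots (suc j) λ p∣1+j →
        ℕ.<⇒≱ (ℕ.<-≤-trans (s<s j<2+d) 2+d<p) (ℕ.∣⇒≤ p∣1+j)))

    ∣-tail : ∀ {n c cs} → All (n ∣_) (c ∷ cs) → All (n ∣_) cs
    ∣-tail (_ ∷ n∣cs) = n∣cs

module Carmichael where

  open Congruence
  open Fermat using (fermat-little)
  open Polynomial using (∀pow≈1⇒p≤1+e)
  open import Defs using (Carmichael)
  open import Data.Nat.DivMod using (_/_; _%_; m≡m%n+[m/n]*n)
  open import Data.Nat.Coprimality using (Coprime; coprime-divisor)
  open import Data.Nat.Primality
    using (prime⇒irreducible; prime[2]; composite-∣; prime⇒¬composite)
  open import Data.Nat.Tactic.RingSolver using () renaming (solve-∀ to solveℕ-∀)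
  open import Data.Integer.Base using (ℤ; +_; _+_; _-_; -_; _*_; _^_; 0ℤ; 1ℤ; -1ℤ)
  import Data.Integer.Properties as ℤ
  open import Data.Integer.Divisibility.Signed using (_∣_; divides; ∣ᵤ⇒∣; ∣⇒∣ᵤ)
  open import Data.Integer.Tactic.RingSolver using (solve-∀)

  %≡%⇒≈mod : ∀ {x y n} .{{_ : NonZero n}} → x % n ≡ y % n → + x ≈ + y mod + n
  %≡%⇒≈mod {x} {y} {n} x%n≡y%n = ≈mod (divides (+ (x / n) - + (y / n)) (begin
    + x - + y
      ≡⟨ cong₂ _-_ (decompose x) (decompose y) ⟩
    (+ (x % n) + + (x / n) * + n) - (+ (y % n) + + (y / n) * + n)
      ≡⟨ cong (λ r → (+ r + + (x / n) * + n) - (+ (y % n) + + (y / n) * + n)) x%n≡y%n ⟩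
    (+ (y % n) + + (x / n) * + n) - (+ (y % n) + + (y / n) * + n)
      ≡⟨ cancel (+ (y % n)) (+ (x / n)) (+ (y / n)) (+ n) ⟩
    (+ (x / n) - + (y / n)) * + n ∎))
    where
    open ≡-Reasoning
    decompose : ∀ z → + z ≡ + (z % n) + + (z / n) * + n
    decompose z = trans (cong +_ (m≡m%n+[m/n]*n z n))
      (trans (ℤ.pos-+ (z % n) _) (cong (_+_ (+ (z % n))) (ℤ.pos-* (z / n) n)))
    cancel : ∀ r a b n → (r + a * n) - (r + b * n) ≡ (a - b) * n
    cancel = solve-∀

  carmichael⇒pow≈1 : ∀ {m a} .{{_ : NonZero m}} → Carmichael m → Coprime a m →
                     (+ a) ^ (m ℕ.∸ 1) ≈ 1ℤ mod + m
  carmichael⇒pow≈1 {m} {a} (_ , korselt) a⊥m =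
    subst (λ z → z ≈ 1ℤ mod + m) (pos-^ a (m ℕ.∸ 1)) (%≡%⇒≈mod (korselt a a⊥m))

  -1^odd : ∀ t → -1ℤ ^ suc (t ℕ.* 2) ≡ -1ℤ
  -1^odd zero    = refl
  -1^odd (suc t) = cong (λ x → -1ℤ * (-1ℤ * x)) (-1^odd t)

  -- (m - 1) ^ (m - 1) ≈ (-1) ^ (m - 1) = -1 for even m, so m ∣ 2.
  carmichael-odd : ∀ {m} .{{_ : NonZero m}} → Carmichael m → ¬ 2 ℕ.∣ m
  carmichael-odd {suc n} car (ℕ.divides (suc t) 1+n≡2+2t) =
    prime⇒¬composite prime[2] (composite-∣ (proj₁ car) 1+n∣2)
    where
    n⊥1+n : Coprime n (suc n)
    n⊥1+n {i} (i∣n , i∣1+n) = ℕ.∣1⇒≡1 (ℕ.∣m+n∣m⇒∣n (subst (i ℕ.∣_) (ℕ.+-comm 1 n) i∣1+n) i∣n)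
    n≈-1 : + n ≈ -1ℤ mod + suc n
    n≈-1 = ≈mod (divides 1ℤ (trans (cong +_ (ℕ.+-comm n 1)) (sym (ℤ.*-identityˡ _))))
    -1≈1 : -1ℤ ≈ 1ℤ mod + suc n
    -1≈1 = ≈mod-trans (≡⇒≈mod (sym (trans (cong (-1ℤ ^_) (ℕ.suc-injective 1+n≡2+2t)) (-1^odd t))))
             (≈mod-trans (≈mod-sym (≈mod-^ n n≈-1)) (carmichael⇒pow≈1 car n⊥1+n))
    1+n∣2 : suc n ℕ.∣ 2
    1+n∣2 = ∣⇒∣ᵤ (∣diff -1≈1)

  coprime-* : ∀ {a b c} → Coprime a b → Coprime a c → Coprime a (b ℕ.* c)
  coprime-* {a} {b} a⊥b a⊥c (i∣a , i∣bc) = a⊥c (i∣a , coprime-divisor i⊥b i∣bc)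
    where
    i⊥b : Coprime _ b
    i⊥b (k∣i , k∣b) = a⊥b (ℕ.∣-trans k∣i i∣a , k∣b)

  coprime-1+multiple : ∀ {b x} → b ℕ.∣ x → Coprime (suc x) b
  coprime-1+multiple {x = x} b∣x {i} (i∣1+x , i∣b) =
    ℕ.∣1⇒≡1 (ℕ.∣m+n∣m⇒∣n (subst (i ℕ.∣_) (ℕ.+-comm 1 x) i∣1+x) (ℕ.∣-trans i∣b b∣x))

  prime∤⇒coprime : ∀ {p a} → Prime p → ¬ p ℕ.∣ a → Coprime a p
  prime∤⇒coprime pp p∤a {i} (i∣a , i∣p) with prime⇒irreducible pp i∣p
  ... | inj₁ i≡1 = i≡1
  ... | inj₂ refl = contradiction i∣a p∤a

  -- The unit a = 1 + c ^ (w - 1) * i is ≈ 1 modulo every divisor of c and, by Fermat, ≈ 1 + i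
  -- modulo w; so it is coprime to m and the Carmichael property for a transfers to 1 + i.
  pow≈1-mod-prime-factor : ∀ {m c w j} .{{_ : NonZero m}} → Carmichael m → m ≡ c ℕ.* w →
                           Prime w → ¬ w ℕ.∣ c → ¬ w ℕ.∣ j → (+ j) ^ (m ℕ.∸ 1) ≈ 1ℤ mod + w
  pow≈1-mod-prime-factor {j = zero} _ _ _ _ w∤0 = contradiction (_ ℕ.∣0) w∤0
  pow≈1-mod-prime-factor {m} {c} {w} {suc i} car m≡c*w pw w∤c w∤1+i =
    ≈mod-trans (≈mod-^ (m ℕ.∸ 1) (≈mod-sym a≈1+i)) (≈mod-∣ w∣m (carmichael⇒pow≈1 car a⊥m))
    where
    a = suc (c ℕ.^ (w ℕ.∸ 1) ℕ.* i)
    cʷ⁻¹i≈i : + (c ℕ.^ (w ℕ.∸ 1) ℕ.* i) ≈ + i mod + w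
    cʷ⁻¹i≈i = ≈mod-trans
      (≡⇒≈mod (trans (ℤ.pos-* (c ℕ.^ (w ℕ.∸ 1)) i) (cong (_* + i) (pos-^ c (w ℕ.∸ 1)))))
      (≈mod-trans (≈mod-* (fermat-little pw w∤c) (≡⇒≈mod refl)) (≡⇒≈mod (ℤ.*-identityˡ (+ i))))
    a≈1+i : + a ≈ + suc i mod + w
    a≈1+i = ≈mod-+ {x = 1ℤ} (≡⇒≈mod refl) cʷ⁻¹i≈i
    c∣cʷ⁻¹ : ∀ k → 0 ℕ.< k → c ℕ.∣ c ℕ.^ k
    c∣cʷ⁻¹ (suc k) _ = ℕ.m∣m*n (c ℕ.^ k)
    w∣m : + w ∣ + m
    w∣m = ∣ᵤ⇒∣ (subst (w ℕ.∣_) (sym m≡c*w) (ℕ.n∣m*n c))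
    a⊥m : Coprime a m
    a⊥m = subst (Coprime a) (sym m≡c*w) (coprime-*
      (coprime-1+multiple (ℕ.∣-trans (c∣cʷ⁻¹ (w ℕ.∸ 1) (ℕ.m<n⇒0<n∸m (prime>1 pw))) (ℕ.m∣m*n i)))
      (prime∤⇒coprime pw λ w∣a → w∤1+i (∣⇒∣ᵤ (≈mod-resp-∣ a≈1+i (∣ᵤ⇒∣ w∣a)))))

  pow-exponent-mod-prime : ∀ {c w j} → Prime w → ¬ w ℕ.∣ j →
                           (+ j) ^ (suc c ℕ.* w ℕ.∸ 1) ≈ (+ j) ^ c mod + w
  pow-exponent-mod-prime {c} {suc v} {j} pw w∤j =
    ≈mod-trans (≡⇒≈mod split)
      (≈mod-trans (≈mod-* (≡⇒≈mod {x = (+ j) ^ c} refl) (≈mod-^ (suc c) (fermat-little pw w∤j)))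
        (≡⇒≈mod (trans (cong ((+ j) ^ c *_) (ℤ.^-zeroˡ (suc c))) (ℤ.*-identityʳ _))))
    where
    open ≡-Reasoning
    exponent : ∀ c v → v ℕ.+ c ℕ.* suc v ≡ c ℕ.+ v ℕ.* suc c
    exponent = solveℕ-∀
    split : (+ j) ^ (v ℕ.+ c ℕ.* suc v) ≡ (+ j) ^ c * ((+ j) ^ v) ^ suc c
    split = begin
      (+ j) ^ (v ℕ.+ c ℕ.* suc v)       ≡⟨ cong ((+ j) ^_) (exponent c v) ⟩
      (+ j) ^ (c ℕ.+ v ℕ.* suc c)       ≡⟨ ℤ.^-distribˡ-+-* (+ j) c _ ⟩
      (+ j) ^ c * (+ j) ^ (v ℕ.* suc c) ≡⟨ cong ((+ j) ^ c *_) (ℤ.^-*-assoc (+ j) v (suc c)) ⟨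
      (+ j) ^ c * ((+ j) ^ v) ^ suc c   ∎

  carmichael-prime-factor-bound : ∀ {m c w} .{{_ : NonZero m}} → Carmichael m →
                                  m ≡ c ℕ.* w → Prime w → ¬ w ℕ.∣ c → 1 ℕ.< c → w ℕ.≤ c
  carmichael-prime-factor-bound {m} {suc e} {w} car m≡c*w pw w∤c (s<s 0<e) =
    ∀pow≈1⇒p≤1+e pw 0<e λ j w∤j → ≈mod-trans (≈mod-sym (pow-exponent-mod-prime {c = e} pw w∤j))
      (subst (λ k → (+ j) ^ (k ℕ.∸ 1) ≈ 1ℤ mod + w) m≡c*w
        (pow≈1-mod-prime-factor car m≡c*w pw w∤c w∤j))

open Carmichael using (carmichael-odd; carmichael-prime-factor-bound)
open import Defs
open import Data.Nat.Base
  using (_+_; _*_; _^_; _∸_; _≤_; _<_; _≥_; >-nonZero; >-nonZero⁻¹; ≢-nonZero⁻¹)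
open import Data.Nat.Properties
open import Data.Nat.DivMod using (_%_; _/_; m<n⇒m%n≡m; m<n⇒m/n≡0; m*n%n≡0; m*n/n≡m)
open import Data.Nat.Divisibility
  using (_∣_; _∣?_; divides; ∣-trans; ∣-refl; n∣m*n; m∣m*n; ∣⇒≤; 0∣⇒≡0)
open import Data.Nat.Induction using (<-rec)
open import Data.Nat.Primality using (prime⇒irreducible)
open import Data.Nat.Primality.Factorisation using (factorise)
open import Data.Nat.ListAction using (product)
open import Data.List.Base using ([]; _∷_)
open import Data.List.Relation.Unary.All using (_∷_)
open import Data.Product using (Σ-syntax)
open import Relation.Nullary using (yes; no)
open import Relation.Binary.Definitions using (tri<; tri≈; tri>)

-- Divisors of products of primes

>1⇒nonZero : ∀ {n} → 1 < n → NonZero n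
>1⇒nonZero 1<n = >-nonZero (<-trans z<s 1<n)

prime-factor : ∀ {n} → 1 < n → ∃ λ p → Prime p × p ∣ n
prime-factor {n} 1<n with factorise n {{>1⇒nonZero 1<n}}
... | record { factors = [] ; isFactorisation = n≡1 } = contradiction n≡1 (>⇒≢ 1<n)
... | record { factors = p ∷ ps ; isFactorisation = n≡p*ps ; factorsPrime = pp ∷ _ } =
  p , pp , divides (product ps) (trans n≡p*ps (*-comm p (product ps)))

prime-splits-product : ∀ {p a b n} → Prime p → a * b ≡ p * n →
                       (∃ λ a′ → a ≡ p * a′ × a′ * b ≡ n) ⊎ (∃ λ b′ → b ≡ p * b′ × a * b′ ≡ n)
prime-splits-product {p} {a} {b} {n} pp ab≡pn
  with euclidsLemma a b pp (divides n (trans ab≡pn (*-comm p n)))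
... | inj₁ (divides a′ a≡a′p) = inj₁ (a′ , a≡pa′ , cancel (begin
  p * (a′ * b) ≡⟨ *-assoc p a′ b ⟨
  p * a′ * b   ≡⟨ cong (_* b) a≡pa′ ⟨
  a * b        ≡⟨ ab≡pn ⟩
  p * n        ∎))
  where
  open ≡-Reasoning
  a≡pa′ = trans a≡a′p (*-comm a′ p)
  cancel = *-cancelˡ-≡ (a′ * b) n p {{prime⇒nonZero pp}}
... | inj₂ (divides b′ b≡b′p) = inj₂ (b′ , b≡pb′ , cancel (begin
  p * (a * b′) ≡⟨ x∙yz≈y∙xz p a b′ ⟩
  a * (p * b′) ≡⟨ cong (a *_) b≡pb′ ⟨
  a * b        ≡⟨ ab≡pn ⟩
  p * n        ∎))
  where
  open ≡-Reasoning
  open import Algebra.Properties.CommutativeSemigroup *-commutativeSemigroup using (x∙yz≈y∙xz)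
  b≡pb′ = trans b≡b′p (*-comm b′ p)
  cancel = *-cancelˡ-≡ (a * b′) n p {{prime⇒nonZero pp}}

*≡prime^⇒≡prime^ : ∀ {p a b} → Prime p → ∀ n → a * b ≡ p ^ n → ∃ λ i → a ≡ p ^ i
*≡prime^⇒≡prime^ {a = a} {b} pp zero    ab≡1 = 0 , m*n≡1⇒m≡1 a b ab≡1
*≡prime^⇒≡prime^ {p}         pp (suc n) ab≡ppⁿ with prime-splits-product pp ab≡ppⁿ
... | inj₁ (a′ , a≡pa′ , a′b≡pⁿ) = let i , a′≡pⁱ = *≡prime^⇒≡prime^ pp n a′b≡pⁿ
                                   in suc i , trans a≡pa′ (cong (p *_) a′≡pⁱ)
... | inj₂ (b′ , _ , ab′≡pⁿ)     = *≡prime^⇒≡prime^ pp n ab′≡pⁿ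

∣prime^⇒≡prime^ : ∀ {p d n} → Prime p → d ∣ p ^ n → ∃ λ i → d ≡ p ^ i
∣prime^⇒≡prime^ {p} {d} {n} pp (divides q pⁿ≡qd) =
  *≡prime^⇒≡prime^ pp n (trans (*-comm d q) (sym pⁿ≡qd))

^-mono-∣ : ∀ p {i j} → i ≤ j → p ^ i ∣ p ^ j
^-mono-∣ p {i} {j} i≤j =
  subst (p ^ i ∣_) (trans (sym (^-distribˡ-+-* p i (j ∸ i))) (cong (p ^_) (m+[n∸m]≡n i≤j)))
    (m∣m*n (p ^ (j ∸ i)))

∣prime^-∣-of-≤ : ∀ {p n d e} → Prime p → d ∣ p ^ n → e ∣ p ^ n → d ≤ e → d ∣ e
∣prime^-∣-of-≤ {p} {n} pp d∣pⁿ e∣pⁿ d≤e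
  with ∣prime^⇒≡prime^ {n = n} pp d∣pⁿ | ∣prime^⇒≡prime^ {n = n} pp e∣pⁿ
... | i , refl | j , refl =
  ^-mono-∣ p (≮⇒≥ λ j<i → <⇒≱ (^-monoʳ-< p (prime>1 pp) {j} {i} j<i) d≤e)

*≡prime⇒≡1 : ∀ {r a b} → Prime r → a * b ≡ r → 1 < a → b ≡ 1
*≡prime⇒≡1 {r} {a} {b} pr ab≡r 1<a with prime⇒irreducible pr (divides a (sym ab≡r))
... | inj₁ b≡1  = b≡1
... | inj₂ refl =
  contradiction (*-cancelʳ-≡ a 1 b {{prime⇒nonZero pr}} (trans ab≡r (sym (*-identityˡ b)))) (>⇒≢ 1<a)

*≡prime*prime⇒prime : ∀ {q r a b} → Prime q → Prime r → a * b ≡ q * r → 1 < a → 1 < b → Prime b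
*≡prime*prime⇒prime {q} {r} {a} {b} pq pr ab≡qr 1<a 1<b
  with prime-splits-product {a = a} {b} pq ab≡qr
... | inj₁ (a′ , _ , a′b≡r) =
  let a′≡1 = *≡prime⇒≡1 pr (trans (*-comm b a′) a′b≡r) 1<b
  in subst Prime (sym (trans (sym (*-identityˡ b)) (trans (cong (_* b) (sym a′≡1)) a′b≡r))) pr
... | inj₂ (b′ , b≡qb′ , ab′≡r) =
  let b′≡1 = *≡prime⇒≡1 pr ab′≡r 1<a
  in subst Prime (sym (trans b≡qb′ (trans (cong (q *_) b′≡1) (*-identityʳ q)))) pq

prime*-cofactor : ∀ {p x y} → Prime p → x ≡ p * y → 1 < x → Prime x ⊎ 1 < y
prime*-cofactor {p} {y = zero}        _  x≡p*0 1<x =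
  contradiction (trans x≡p*0 (*-zeroʳ p)) (≢-nonZero⁻¹ _ {{>1⇒nonZero 1<x}})
prime*-cofactor {p} {y = suc zero}    pp x≡p*1 _   =
  inj₁ (subst Prime (sym (trans x≡p*1 (*-identityʳ p))) pp)
prime*-cofactor     {y = suc (suc _)} _  _     _   = inj₂ (s<s z<s)

*≡prime³⇒prime⊎prime : ∀ {p q r a b} → Prime p → Prime q → Prime r → a * b ≡ p * (q * r) →
                       1 < a → 1 < b → Prime a ⊎ Prime b
*≡prime³⇒prime⊎prime {a = a} {b} pp pq pr ab≡pqr 1<a 1<b
  with prime-splits-product {a = a} {b} pp ab≡pqr
... | inj₁ (a′ , a≡pa′ , a′b≡qr) with prime*-cofactor pp a≡pa′ 1<a
...   | inj₁ a-prime = inj₁ a-prime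
...   | inj₂ 1<a′    = inj₂ (*≡prime*prime⇒prime pq pr a′b≡qr 1<a′ 1<b)
*≡prime³⇒prime⊎prime {a = a} {b} pp pq pr ab≡pqr 1<a 1<b
  | inj₂ (b′ , b≡pb′ , ab′≡qr) with prime*-cofactor pp b≡pb′ 1<b
...   | inj₁ b-prime = inj₂ b-prime
...   | inj₂ 1<b′    = inj₁ (*≡prime*prime⇒prime pq pr (trans (*-comm b′ a) ab′≡qr) 1<b′ 1<a)

-- Digit sums and exact powers

digitSumFuel-0 : ∀ f g → digitSumFuel f g 0 ≡ 0
digitSumFuel-0 zero    g             = refl
digitSumFuel-0 (suc f) zero          = refl
digitSumFuel-0 (suc f) (suc zero)    = refl
digitSumFuel-0 (suc f) (suc (suc h)) = digitSumFuel-0 f (suc (suc h))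

digitSumFuel-digit : ∀ {f g k} → 1 < g → k < g → digitSumFuel (suc f) g k ≡ k
digitSumFuel-digit {f} {g@(suc (suc _))} {k} (s≤s (s≤s z≤n)) k<g = begin
  k % g + digitSumFuel f g (k / g)
    ≡⟨ cong₂ (λ r q → r + digitSumFuel f g q) (m<n⇒m%n≡m k<g) (m<n⇒m/n≡0 k<g) ⟩
  k + digitSumFuel f g 0 ≡⟨ cong (k +_) (digitSumFuel-0 f g) ⟩
  k + 0                  ≡⟨ +-identityʳ k ⟩
  k                      ∎
  where open ≡-Reasoning

digitSumFuel-shift : ∀ {f g} t → 1 < g → digitSumFuel (suc f) g (t * g) ≡ digitSumFuel f g t
digitSumFuel-shift {f} {g@(suc (suc _))} t (s≤s (s≤s z≤n)) =
  cong₂ (λ r q → r + digitSumFuel f g q) (m*n%n≡0 t g) (m*n/n≡m t g)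

digitSumFuel-pow*digit : ∀ {g} → 1 < g → ∀ n {k f} → k < g → g ^ n * k ≤ f →
                         digitSumFuel f g (g ^ n * k) ≡ k
digitSumFuel-pow*digit {g} _ n {zero} {f} _ _ =
  trans (cong (digitSumFuel f g) (*-zeroʳ (g ^ n))) (digitSumFuel-0 f g)
digitSumFuel-pow*digit {g@(suc _)} _ n {suc k} {zero} _ gⁿk≤0 =
  contradiction (n≤0⇒n≡0 gⁿk≤0) (≢-nonZero⁻¹ _ {{m*n≢0 (g ^ n) (suc k) {{m^n≢0 g n}}}})
digitSumFuel-pow*digit {g} 1<g zero {suc k} {suc f} k<g _ =
  trans (cong (digitSumFuel (suc f) g) (*-identityˡ (suc k))) (digitSumFuel-digit 1<g k<g)
digitSumFuel-pow*digit {g@(suc _)} 1<g (suc n) {suc k} {suc f} k<g gⁿ⁺¹k≤1+f = begin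
  digitSumFuel (suc f) g (g ^ suc n * suc k) ≡⟨ cong (digitSumFuel (suc f) g) gⁿ⁺¹k≡gⁿk*g ⟩
  digitSumFuel (suc f) g (gⁿk * g)           ≡⟨ digitSumFuel-shift gⁿk 1<g ⟩
  digitSumFuel f g gⁿk                       ≡⟨ digitSumFuel-pow*digit 1<g n k<g gⁿk≤f ⟩
  suc k                                      ∎
  where
  open ≡-Reasoning
  gⁿk = g ^ n * suc k
  gⁿ⁺¹k≡gⁿk*g : g ^ suc n * suc k ≡ gⁿk * g
  gⁿ⁺¹k≡gⁿk*g = trans (*-assoc g (g ^ n) (suc k)) (*-comm g gⁿk)
  gⁿk≤f : gⁿk ≤ f
  gⁿk≤f = ≤-pred (<-≤-trans (m<m*n gⁿk g {{m*n≢0 (g ^ n) (suc k) {{m^n≢0 g n}}}} 1<g)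
                            (subst (_≤ suc f) gⁿ⁺¹k≡gⁿk*g gⁿ⁺¹k≤1+f))

s-pow*digit : ∀ {g k} → 1 < g → ∀ n → k < g → s g (g ^ n * k) ≡ k
s-pow*digit 1<g n k<g = digitSumFuel-pow*digit 1<g n k<g ≤-refl

digit-sum-base>1 : ∀ {g m} .{{_ : NonZero m}} → g ∣ m → g ≤ s g m → 1 < g
digit-sum-base>1 {zero}          {m} 0∣m _ = contradiction (0∣⇒≡0 0∣m) (≢-nonZero⁻¹ m)
digit-sum-base>1 {suc zero}      {suc _} _ ()
digit-sum-base>1 {suc (suc _)}           _ _ = s≤s (s≤s z≤n)

-- The digit sum of g ^ n * k is that of k, which is k itself when k is a single digit.
cofactor-large : ∀ {g m n k} → 1 < g → m ≡ g ^ n * k → ¬ g ∣ k → g ≤ s g m → g < k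
cofactor-large {g} {m} {n} {k} 1<g m≡gⁿk g∤k g≤s[m] with <-cmp k g
... | tri< k<g _ _  =
  contradiction (subst (g ≤_) (trans (cong (s g) m≡gⁿk) (s-pow*digit 1<g n k<g)) g≤s[m]) (<⇒≱ k<g)
... | tri≈ _ refl _ = contradiction ∣-refl g∤k
... | tri> _ _ g<k  = g<k

exact-power : ∀ {b} → 1 < b → ∀ m → 0 < m → ∃₂ λ n k → m ≡ b ^ n * k × ¬ b ∣ k
exact-power {b} 1<b = <-rec _ split
  where
  split : ∀ m → (∀ {m′} → m′ < m → 0 < m′ → ∃₂ λ n k → m′ ≡ b ^ n * k × ¬ b ∣ k) →
          0 < m → ∃₂ λ n k → m ≡ b ^ n * k × ¬ b ∣ k
  split m rec 0<m with b ∣? m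
  ... | no  b∤m = 0 , m , sym (*-identityˡ m) , b∤m
  ... | yes (divides q m≡qb) =
    let n , k , q≡bⁿk , b∤k = rec q<m 0<q
    in suc n , k , trans m≡qb (trans (cong (_* b) q≡bⁿk) (rearrange (b ^ n) k)) , b∤k
    where
    0<q : 0 < q
    0<q = n≢0⇒n>0 λ q≡0 → >⇒≢ 0<m (trans m≡qb (cong (_* b) q≡0))
    q<m : q < m
    q<m = subst (q <_) (sym m≡qb) (m<m*n q b {{>-nonZero 0<q}} 1<b)
    rearrange : ∀ x k → x * k * b ≡ b * x * k
    rearrange x k = trans (*-comm (x * k) b) (sym (*-assoc b x k))

IsOrd⇒exact : ∀ {g m n} → IsOrd g m n → ∃ λ k → m ≡ g ^ n * k × ¬ g ∣ k
IsOrd⇒exact {g} {m} {n} (divides q m≡qgⁿ , maximal) = q , trans m≡qgⁿ (*-comm q (g ^ n)) , g∤q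
  where
  g∤q : ¬ g ∣ q
  g∤q (divides r q≡rg) = <⇒≱ (n<1+n n)
    (maximal (suc n) (divides r (trans m≡qgⁿ (trans (cong (_* g ^ n) q≡rg) (*-assoc r g (g ^ n))))))

exact-power-bound : ∀ {g m n k} → 1 < g → g ∣ m → m ≡ g ^ n * k → ¬ g ∣ k → g < k →
                    g ^ suc n < m × 2 ≤ suc n
exact-power-bound {g} {m} {zero}  {k} _ g∣m m≡1*k g∤k _ =
  contradiction (subst (g ∣_) (trans m≡1*k (*-identityˡ k)) g∣m) g∤k
exact-power-bound {g} {m} {suc n} {k} 1<g _ m≡gⁿk _ g<k =
  subst (_< m) (*-comm (g ^ suc n) g)
    (subst (g ^ suc n * g <_) (sym m≡gⁿk)
      (*-monoʳ-< (g ^ suc n) {{m^n≢0 g (suc n) {{>1⇒nonZero 1<g}}}} g<k)) ,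
  s≤s (s≤s z≤n)

two-prime-divisors : ∀ {m g n k} → 0 < m → 1 < g → g ∣ m → m ≡ g ^ n * k → ¬ g ∣ k → g < k →
                     Σ[ p ∈ ℕ ] Σ[ q ∈ ℕ ] (Prime p × Prime q × p ≢ q × p ∣ m × q ∣ m)
two-prime-divisors {m} {g} {n} {k} 0<m 1<g g∣m m≡gⁿk g∤k g<k with prime-factor 1<g
... | p , pp , p∣g with exact-power (prime>1 pp) m 0<m
...   | a , zero , m≡pᵃ*0 , _ = contradiction (trans m≡pᵃ*0 (*-zeroʳ (p ^ a))) (>⇒≢ 0<m)
...   | a , suc zero , m≡pᵃ*1 , _ =
  contradiction (∣prime^-∣-of-≤ {n = a} pp (subst (g ∣_) m≡pᵃ g∣m) (subst (k ∣_) m≡pᵃ k∣m) (<⇒≤ g<k))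
                g∤k
  where
  m≡pᵃ = trans m≡pᵃ*1 (*-identityʳ (p ^ a))
  k∣m = subst (k ∣_) (sym m≡gⁿk) (n∣m*n (g ^ n))
...   | a , r@(suc (suc _)) , m≡pᵃr , p∤r with prime-factor {r} (s≤s (s≤s z≤n))
...     | q , pq , q∣r =
  p , q , pp , pq , (λ { refl → p∤r q∣r }) , ∣-trans p∣g g∣m ,
  ∣-trans q∣r (subst (r ∣_) (sym m≡pᵃr) (n∣m*n (p ^ a)))

carmichael-divisor-prime : ∀ {m g p q r} .{{_ : NonZero m}} → Carmichael m → m ≡ p * q * r →
                           Prime p → Prime q → Prime r → g ∣ m → 1 < g → g * g < m →
                           Prime g × g ≢ 2
carmichael-divisor-prime {m} {g} {p} {q} {r} car m≡pqr pp pq pr g∣m@(divides c m≡cg) 1<g g²<m =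
  [ (λ g-prime → g-prime , λ { refl → carmichael-odd car g∣m })
  , (λ c-prime → contradiction (carmichael-prime-factor-bound car m≡gc c-prime c∤g 1<g) (<⇒≱ g<c))
  ]′ (*≡prime³⇒prime⊎prime pp pq pr gc≡pqr 1<g (<-trans 1<g g<c))
  where
  m≡gc = trans m≡cg (*-comm c g)
  gc≡pqr = trans (sym m≡gc) (trans m≡pqr (*-assoc p q r))
  g<c = *-cancelˡ-< g g c (subst (g * g <_) m≡gc g²<m)
  c∤g : ¬ c ∣ g
  c∤g c∣g = <⇒≱ g<c (∣⇒≤ {{>1⇒nonZero 1<g}} c∣g)

theorem2p3 : (m g : ℕ) → .{{_ : NonZero m}} → g ∣ m → s g m ≥ g →
    (Σ[ p ∈ ℕ ] Σ[ q ∈ ℕ ] (Prime p × Prime q × p ≢ q × p ∣ m × q ∣ m))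
    × ((Carmichael m → (Σ[ p ∈ ℕ ] Σ[ q ∈ ℕ ] Σ[ r ∈ ℕ ] (Prime p × Prime q × Prime r × m ≡ p * q * r)) → Prime g × g ≢ 2))
    × (1 < g × (∀ n → IsOrd g m n → g ^ suc n < m × 2 ≤ suc n))
theorem2p3 m g g∣m g≤s[m] with digit-sum-base>1 g∣m g≤s[m]
... | 1<g with exact-power 1<g m (>-nonZero⁻¹ m)
...   | n , k , m≡gⁿk , g∤k =
  two-prime-divisors {n = n} (>-nonZero⁻¹ m) 1<g g∣m m≡gⁿk g∤k g<k ,
  (λ car (_ , _ , _ , pp , pq , pr , m≡pqr) →
     carmichael-divisor-prime car m≡pqr pp pq pr g∣m 1<g g²<m) ,
  1<g ,
  ord-bound
  where
  g<k = cofactor-large {n = n} 1<g m≡gⁿk g∤k g≤s[m]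
  ord-bound : ∀ n → IsOrd g m n → g ^ suc n < m × 2 ≤ suc n
  ord-bound n isOrd = let k′ , m≡gⁿk′ , g∤k′ = IsOrd⇒exact isOrd in
    exact-power-bound {n = n} 1<g g∣m m≡gⁿk′ g∤k′
      (cofactor-large {n = n} 1<g m≡gⁿk′ g∤k′ g≤s[m])
  g²<m : g * g < m
  g²<m = let gⁿ⁺¹<m , 2≤1+n = exact-power-bound {n = n} 1<g g∣m m≡gⁿk g∤k g<k in
    ≤-<-trans (subst (_≤ g ^ suc n) (cong (g *_) (*-identityʳ g))
                     (^-monoʳ-≤ g {{>1⇒nonZero 1<g}} 2≤1+n))
              gⁿ⁺¹<m
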